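{- Let $\mathcal C\subseteq 2^{[n]}$ be a code, let $T_1,\ldots,T_m$ be trunks in $\mathcal C$, and let $T$ be a trunk in $\mathcal C$ generated by $\{T_1,\ldots,T_m\}$. Let $f:\mathcal C\to 2^{[m]}$ be the morphism determined by $\{T_1,\ldots,T_m\}$ and $g:\mathcal C\to 2^{[m+1]}$ the morphism determined by $\{T_1,\ldots,T_m,T_{m+1}\}$ with $T_{m+1}=T$. Then the codes $f(\mathcal C)$ and $g(\mathcal C)$ are isomorphic.
   Context: A code is a subset $\mathcal C\subseteq 2^{[n]}$. For $\sigma\subseteq[n]$, $\mathrm{Tk}_{\mathcal C}(\sigma)=\{c\in\mathcal C\mid\sigma\subseteq c\}$. A trunk in $\mathcal C$ is a subset of $\mathcal C$ that is empty or equal to $\mathrm{Tk}_{\mathcal C}(\sigma)$ for some $\sigma$. A morphism between codes $\mathcal C\subseteq 2^{[n]}$, $\mathcal D\subseteq 2^{[m]}$ is a function $\mathcal C\to\mathcal D$ under which the preimage of every trunk in $\mathcal D$ is a trunk in $\mathcal C$; an isomorphism is a bijective morphism whose inverse is a morphism. Given trunks $T_1,\ldots,T_m$ in $\mathcal C$, the morphism determined by them is $c\mapsto\{j\in[m]\mid c\in T_j\}$, $\mathcal C\to 2^{[m]}$. A trunk $T$ is generated by $\{T_j\}$ if $T$ is an intersection of some of the $T_j$. -}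

module Defs where

open import Data.Nat using (ℕ; zero; suc)
open import Data.Bool using (Bool; true; false; _∧_; _∨_)
import Data.Bool.Properties as BoolP
open import Data.Fin using (Fin; zero; suc; fromℕ; inject₁)
open import Data.Fin.Subset using (Subset; _⊆_; _∈_)
open import Data.Vec using (Vec; []; _∷_; tabulate)
open import Data.Vec.Properties using (≡-dec)
open import Data.Product using (Σ; _×_; _,_; proj₁; ∃-syntax)
open import Data.Sum using (_⊎_)
open import Relation.Nullary using (does)
open import Relation.Binary.PropositionalEquality using (_≡_)
open import Function using (_∘_)
open import Function.Bundles using (_⇔_)

Code : ℕ → Set
Code n = Subset n → Bool

Elem : {n : ℕ} → Code n → Set
Elem {n} C = Σ (Subset n) (λ c → C c ≡ true)

SubsetOf : {n : ℕ} → Code n → Set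
SubsetOf C = Elem C → Bool

-- Tk_C(σ) membership: σ ⊆ c.
-- A trunk in C: empty, or (extensionally) equal to Tk_C(σ) for some σ.
IsTrunk : {n : ℕ} (C : Code n) → SubsetOf C → Set
IsTrunk {n} C T =
  (∀ x → T x ≡ false) ⊎ (Σ (Subset n) λ σ → ∀ x → (T x ≡ true) ⇔ (σ ⊆ proj₁ x))

IsMorphism : {n m : ℕ} (C : Code n) (D : Code m) → (Elem C → Elem D) → Set
IsMorphism C D f = ∀ (T : SubsetOf D) → IsTrunk D T → IsTrunk C (T ∘ f)

Isomorphic : {n m : ℕ} (C : Code n) (D : Code m) → Set
Isomorphic C D =
  Σ (Elem C → Elem D) λ f → Σ (Elem D → Elem C) λ g →
    IsMorphism C D f × IsMorphism D C g ×
    (∀ x → g (f x) ≡ x) × (∀ y → f (g y) ≡ y)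

determined : {n m : ℕ} {C : Code n} → (Fin m → SubsetOf C) → Elem C → Subset m
determined Ts x = tabulate (λ j → Ts j x)

anySubset : {n : ℕ} → (Subset n → Bool) → Bool
anySubset {zero} p = p []
anySubset {suc n} p = anySubset (λ s → p (true ∷ s)) ∨ anySubset (λ s → p (false ∷ s))

guard : (b : Bool) → (b ≡ true → Bool) → Bool
guard true k = k _≡_.refl
guard false k = false

image : {n m : ℕ} (C : Code n) → (Elem C → Subset m) → Code m
image C f y = anySubset (λ c → guard (C c) (λ p → does (≡-dec BoolP._≟_ (f (c , p)) y)))

-- T is generated by T_1..T_m: T is the intersection of the T_j with j ∈ S,
-- for some S ⊆ [m] (the empty intersection being all of C).
GeneratedBy : {n m : ℕ} {C : Code n} → SubsetOf C → (Fin m → SubsetOf C) → Set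
GeneratedBy {m = m} T Ts =
  ∃[ S ] (∀ x → (T x ≡ true) ⇔ (∀ (j : Fin m) → j ∈ S → Ts j x ≡ true))

snoc : {A : Set} {m : ℕ} → (Fin m → A) → A → Fin (suc m) → A
snoc {m = zero} Ts T zero = T
snoc {m = suc m} Ts T zero = Ts zero
snoc {m = suc m} Ts T (suc j) = snoc (Ts ∘ suc) T j

-- Writing S for the index set whose T_j intersect to T, the new coordinate of g(c) is
-- the indicator of S ⊆ f(c), i.e. of the trunk Tk(S) of f(C). So g = e ∘ f with
-- e y = y ∷ʳ [S ⊆ y], and dropping the last coordinate is a left inverse of e. Both
-- e and this projection pull trunks Tk(τ) back to trunks, so they restrict to mutually
-- inverse morphisms between f(C) and g(C).
module Submission where

open import Defs
open import Data.Nat using (ℕ; zero; suc)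
open import Data.Bool using (Bool; true; false; _∨_)
import Data.Bool.Properties as BoolP
open import Data.Fin using (Fin; zero; suc)
open import Data.Fin.Subset using (Subset; _⊆_; _∈_; _∪_)
open import Data.Fin.Subset.Properties using (drop-∷-⊆; _⊆?_; p⊆p∪q; q⊆p∪q; x∈p∪q⁻)
open import Data.Vec using ([]; _∷_; tabulate; _∷ʳ_; init; initLast; here; there)
open import Data.Vec.Properties using (≡-dec; []=⇒lookup; lookup⇒[]=; lookup∘tabulate; init-∷ʳ)
open import Data.Product using (Σ; _×_; _,_; proj₁; proj₂; ∃-syntax)
open import Data.Product.Function.NonDependent.Propositional using (_×-⇔_)
open import Data.Sum using (_⊎_; inj₁; inj₂; [_,_])
open import Data.Sum.Function.Propositional using (_⊎-⇔_)
open import Relation.Nullary using (Dec; does; yes; no)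
open import Data.Empty using (⊥-elim)
open import Relation.Binary.PropositionalEquality using (_≡_; refl; sym; trans; cong)
open import Axiom.UniquenessOfIdentityProofs using (module Decidable⇒UIP)
open import Function using (_∘_; id)
open import Function.Bundles using (_⇔_; mk⇔; Equivalence)
open import Function.Properties.Equivalence using () renaming (refl to ⇔-refl; sym to ⇔-sym; trans to ⇔-trans)

open Equivalence

private
  variable
    n m k : ℕ

infixr 4 _⟫_
_⟫_ : {A B C : Set} → A ⇔ B → B ⇔ C → A ⇔ C
_⟫_ = ⇔-trans

true⇒-⇔ : {A : Set} → (true ≡ true → A) ⇔ A
true⇒-⇔ = mk⇔ (λ h → h refl) (λ a _ → a)

×-false⇒-⇔ : {A B : Set} → (A × (false ≡ true → B)) ⇔ A
×-false⇒-⇔ = mk⇔ proj₁ (_, λ ())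

∨-true⇔ : {a b : Bool} → (a ∨ b) ≡ true ⇔ (a ≡ true ⊎ b ≡ true)
∨-true⇔ {true}  = mk⇔ (λ _ → inj₁ refl) (λ _ → refl)
∨-true⇔ {false} = mk⇔ inj₂ [ (λ ()) , id ]

does-true⇔ : {A : Set} (a? : Dec A) → does a? ≡ true ⇔ A
does-true⇔ (yes a) = mk⇔ (λ _ → a) (λ _ → refl)
does-true⇔ (no ¬a) = mk⇔ (λ ()) (⊥-elim ∘ ¬a)

guard-true⇔ : {b : Bool} {k : b ≡ true → Bool} →
  guard b k ≡ true ⇔ Σ (b ≡ true) (λ p → k p ≡ true)
guard-true⇔ {true}  = mk⇔ (refl ,_) (λ { (refl , e) → e })
guard-true⇔ {false} = mk⇔ (λ ()) (λ { (() , _) })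

anySubset-true⇔ : (p : Subset n → Bool) → anySubset p ≡ true ⇔ (∃[ s ] p s ≡ true)
anySubset-true⇔ {zero}  p = mk⇔ ([] ,_) (λ { ([] , e) → e })
anySubset-true⇔ {suc n} p =
  ∨-true⇔ ⟫ (anySubset-true⇔ (p ∘ (true ∷_)) ⊎-⇔ anySubset-true⇔ (p ∘ (false ∷_))) ⟫
  mk⇔ [ (λ (s , e) → true ∷ s , e) , (λ (s , e) → false ∷ s , e) ]
      (λ { (true ∷ s , e) → inj₁ (s , e) ; (false ∷ s , e) → inj₂ (s , e) })

∈-tabulate⇔ : {b : Fin m → Bool} {j : Fin m} → j ∈ tabulate b ⇔ b j ≡ true
∈-tabulate⇔ {b = b} {j} =
  mk⇔ (λ j∈ → trans (sym (lookup∘tabulate b j)) ([]=⇒lookup j∈))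
      (λ e → lookup⇒[]= j (tabulate b) (trans (lookup∘tabulate b j) e))

∪-⊆-⇔ : {p q r : Subset m} → (p ∪ q) ⊆ r ⇔ (p ⊆ r × q ⊆ r)
∪-⊆-⇔ {p = p} {q} {r} = mk⇔ split lub
  where
  split : (p ∪ q) ⊆ r → p ⊆ r × q ⊆ r
  split h = (λ x∈ → h (p⊆p∪q q x∈)) , (λ x∈ → h (q⊆p∪q p q x∈))
  lub : p ⊆ r × q ⊆ r → (p ∪ q) ⊆ r
  lub (p⊆r , q⊆r) x∈ with x∈p∪q⁻ p q x∈
  ... | inj₁ x∈p = p⊆r x∈p
  ... | inj₂ x∈q = q⊆r x∈q

∷-⊆-∷-⇔ : {s t : Bool} {p q : Subset m} →
  (s ∷ p) ⊆ (t ∷ q) ⇔ ((s ≡ true → t ≡ true) × p ⊆ q)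
∷-⊆-∷-⇔ {s = s} {t} {p} {q} = mk⇔ uncons cons
  where
  uncons : (s ∷ p) ⊆ (t ∷ q) → (s ≡ true → t ≡ true) × p ⊆ q
  uncons h = (λ { refl → []=⇒lookup (h here) }) , drop-∷-⊆ h
  cons : (s ≡ true → t ≡ true) × p ⊆ q → (s ∷ p) ⊆ (t ∷ q)
  cons (s⇒t , p⊆q) here      = lookup⇒[]= zero (t ∷ q) (s⇒t refl)
  cons (s⇒t , p⊆q) (there x∈) = there (p⊆q x∈)

∷ʳ-⊆-∷ʳ-⇔ : {s t : Bool} {p q : Subset m} →
  (p ∷ʳ s) ⊆ (q ∷ʳ t) ⇔ (p ⊆ q × (s ≡ true → t ≡ true))
∷ʳ-⊆-∷ʳ-⇔ {p = []}    {[]}    = ∷-⊆-∷-⇔ ⟫ mk⇔ (λ (s⇒t , _) → (λ ()) , s⇒t) (λ (_ , s⇒t) → s⇒t , λ ())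
∷ʳ-⊆-∷ʳ-⇔ {s = s} {t} {a ∷ p} {b ∷ q} =
  ∷-⊆-∷-⇔ ⟫ (⇔-refl ×-⇔ ∷ʳ-⊆-∷ʳ-⇔) ⟫ mk⇔ regroup ungroup
  where
  regroup : (a ≡ true → b ≡ true) × p ⊆ q × (s ≡ true → t ≡ true) →
            (a ∷ p) ⊆ (b ∷ q) × (s ≡ true → t ≡ true)
  regroup (a⇒b , p⊆q , s⇒t) = from ∷-⊆-∷-⇔ (a⇒b , p⊆q) , s⇒t
  ungroup : (a ∷ p) ⊆ (b ∷ q) × (s ≡ true → t ≡ true) →
            (a ≡ true → b ≡ true) × p ⊆ q × (s ≡ true → t ≡ true)
  ungroup (ap⊆bq , s⇒t) = to ∷-⊆-∷-⇔ ap⊆bq .proj₁ , to ∷-⊆-∷-⇔ ap⊆bq .proj₂ , s⇒t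

PullsBackTrunks : (Subset m → Subset k) → Set
PullsBackTrunks {m} h = ∀ τ → ∃[ σ ] ∀ (y : Subset m) → τ ⊆ h y ⇔ σ ⊆ y

extendByTrunk : Subset m → Subset m → Subset (suc m)
extendByTrunk S y = y ∷ʳ does (S ⊆? y)

extendByTrunk-pullsBackTrunks : (S : Subset m) → PullsBackTrunks (extendByTrunk S)
extendByTrunk-pullsBackTrunks S τ with initLast τ
... | ρ , false , refl = ρ , λ y → ∷ʳ-⊆-∷ʳ-⇔ ⟫ ×-false⇒-⇔
... | ρ , true  , refl = ρ ∪ S , λ y →
  ∷ʳ-⊆-∷ʳ-⇔ ⟫ (⇔-refl ×-⇔ (true⇒-⇔ ⟫ does-true⇔ (S ⊆? y))) ⟫ ⇔-sym ∪-⊆-⇔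

init-pullsBackTrunks : PullsBackTrunks (init {A = Bool} {n = m})
init-pullsBackTrunks σ = σ ∷ʳ false , pullback
  where
  pullback : ∀ z → σ ⊆ init z ⇔ (σ ∷ʳ false) ⊆ z
  pullback z with initLast z
  ... | ρ , b , refl = ⇔-sym (∷ʳ-⊆-∷ʳ-⇔ ⟫ ×-false⇒-⇔)

Elem-≡ : {D : Code m} {y z : Elem D} → proj₁ y ≡ proj₁ z → y ≡ z
Elem-≡ {y = y , p} {.y , q} refl = cong (y ,_) (Decidable⇒UIP.≡-irrelevant BoolP._≟_ p q)

restrict : {D : Code m} {E : Code k} (h : Subset m → Subset k) →
  (∀ y → D y ≡ true → E (h y) ≡ true) → Elem D → Elem E
restrict h h∈ (y , y∈) = h y , h∈ y y∈

restrict-isMorphism : {D : Code m} {E : Code k} (h : Subset m → Subset k)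
  (h∈ : ∀ y → D y ≡ true → E (h y) ≡ true) → PullsBackTrunks h → IsMorphism D E (restrict h h∈)
restrict-isMorphism h h∈ pullback T (inj₁ empty) = inj₁ (empty ∘ restrict h h∈)
restrict-isMorphism h h∈ pullback T (inj₂ (τ , T⇔)) with pullback τ
... | σ , σ⇔ = inj₂ (σ , λ { (y , y∈) → T⇔ (restrict h h∈ (y , y∈)) ⟫ σ⇔ y })

∈-image⇔ : (C : Code n) (f : Elem C → Subset m) {y : Subset m} →
  image C f y ≡ true ⇔ (∃[ x ] f x ≡ y)
∈-image⇔ C f {y} = mk⇔ sound complete
  where
  y≟ : ∀ x → Dec (f x ≡ y)
  y≟ x = ≡-dec BoolP._≟_ (f x) y
  sound : image C f y ≡ true → ∃[ x ] f x ≡ y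
  sound e with to (anySubset-true⇔ _) e
  ... | c , g with to guard-true⇔ g
  ... | p , d = (c , p) , to (does-true⇔ (y≟ (c , p))) d
  complete : ∃[ x ] f x ≡ y → image C f y ≡ true
  complete ((c , p) , fx≡y) =
    from (anySubset-true⇔ _) (c , from guard-true⇔ (p , from (does-true⇔ (y≟ (c , p))) fx≡y))

image-Isomorphic : (C : Code n) (f : Elem C → Subset m) (g : Elem C → Subset k)
  (e : Subset m → Subset k) (r : Subset k → Subset m) →
  (∀ y → r (e y) ≡ y) → (∀ x → g x ≡ e (f x)) → PullsBackTrunks e → PullsBackTrunks r →
  Isomorphic (image C f) (image C g)
image-Isomorphic C f g e r r∘e g≡e∘f e-pullback r-pullback =
  restrict e e∈ , restrict r r∈ ,
  restrict-isMorphism e e∈ e-pullback , restrict-isMorphism r r∈ r-pullback ,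
  (λ (y , _) → Elem-≡ (r∘e y)) , (λ (z , z∈) → Elem-≡ (e∘r-on-image z∈))
  where
  r-on-image : ∀ {x z} → g x ≡ z → r z ≡ f x
  r-on-image {x} refl = trans (cong r (g≡e∘f x)) (r∘e (f x))

  e∈ : ∀ y → image C f y ≡ true → image C g (e y) ≡ true
  e∈ y y∈ with to (∈-image⇔ C f) y∈
  ... | x , refl = from (∈-image⇔ C g) (x , g≡e∘f x)

  r∈ : ∀ z → image C g z ≡ true → image C f (r z) ≡ true
  r∈ z z∈ with to (∈-image⇔ C g) z∈
  ... | x , gx≡z = from (∈-image⇔ C f) (x , sym (r-on-image gx≡z))

  e∘r-on-image : ∀ {z} → image C g z ≡ true → e (r z) ≡ z
  e∘r-on-image z∈ with to (∈-image⇔ C g) z∈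
  ... | x , refl = trans (cong e (r-on-image refl)) (sym (g≡e∘f x))

determined-snoc : {C : Code n} (Ts : Fin m → SubsetOf C) (T : SubsetOf C) (x : Elem C) →
  determined (snoc Ts T) x ≡ determined Ts x ∷ʳ T x
determined-snoc {m = zero}  Ts T x = refl
determined-snoc {m = suc m} Ts T x = cong (Ts zero x ∷_) (determined-snoc (Ts ∘ suc) T x)

generated-indicator : {C : Code n} {Ts : Fin m → SubsetOf C} {T : SubsetOf C} →
  (gen : GeneratedBy T Ts) → ∀ x → T x ≡ does (proj₁ gen ⊆? determined Ts x)
generated-indicator {Ts = Ts} (S , T⇔) x =
  BoolP.⇔→≡ (T⇔ x ⟫ ∀∈⇔⊆ ⟫ ⇔-sym (does-true⇔ (S ⊆? determined Ts x)))
  where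
  ∀∈⇔⊆ : (∀ j → j ∈ S → Ts j x ≡ true) ⇔ S ⊆ determined Ts x
  ∀∈⇔⊆ = mk⇔ (λ h {j} j∈S → from ∈-tabulate⇔ (h j j∈S)) (λ h j j∈S → to ∈-tabulate⇔ (h j∈S))

corollary3p14 : (n m : ℕ) (C : Code n) (Ts : Fin m → SubsetOf C) →
    (∀ j → IsTrunk C (Ts j)) →
    (T : SubsetOf C) → IsTrunk C T → GeneratedBy T Ts →
    Isomorphic (image C (determined Ts)) (image C (determined (snoc Ts T)))
corollary3p14 n m C Ts _ T _ gen@(S , _) =
  image-Isomorphic C (determined Ts) (determined (snoc Ts T)) (extendByTrunk S) init
    (λ y → init-∷ʳ (does (S ⊆? y)) y) g≡e∘f
    (extendByTrunk-pullsBackTrunks S) init-pullsBackTrunks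
  where
  g≡e∘f : ∀ x → determined (snoc Ts T) x ≡ extendByTrunk S (determined Ts x)
  g≡e∘f x = trans (determined-snoc Ts T x) (cong (determined Ts x ∷ʳ_) (generated-indicator gen x))
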